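{- Let $v\ge1$, $n=2^v$, and let $x,y$ be integers with $0\le x\le n-1$, $-1\le y\le n-1$ and $x\le y+1$. Define $$\alpha^{\mathrm K}_{x,y}\;=\;m_{n-1}\to\bigvee_{\varepsilon\in E(x,y)}\Big(m_{n-1}\wedge\bigwedge_{i=0}^{n-1}\Diamond^{\varepsilon_i}m_i\Big),$$ where $E(x,y)=\{\varepsilon\in\{0,1\}^n:\varepsilon_{n-1}=0,\ \chi(\varepsilon)\le x\}\cup\{\varepsilon\in\{0,1\}^n:\varepsilon_{n-1}=1,\ \chi(\varepsilon)\le y+1\}$, and $\alpha^{\mathrm D}_{x,y}=\Diamond 1\wedge\alpha^{\mathrm K}_{x,y}$. Put $X=\infty$ if $x=y=n-1$ and $X=x$ otherwise; put $Y=\infty$ if $y=n-1$ and $Y=y$ otherwise. For a world $w$ of a Kripke frame $(W,R)$ let $o(w)$ be the number of worlds $w'\ne w$ with $wRw'$. Then for every Kripke frame $\mathscr F=(W,R)$: (a) $\alpha^{\mathrm K}_{x,y}$ is valid on $\mathscr F$ if and only if every $w\in W$ satisfies either ($w$ is not $R$-reflexive and $o(w)\le X$) or ($w$ is $R$-reflexive and $o(w)\le Y$); (b) $\alpha^{\mathrm D}_{x,y}$ is valid on $\mathscr F$ if and only if every $w\in W$ satisfies either ($w$ is not $R$-reflexive and $1\le o(w)\le X$) or ($w$ is $R$-reflexive and $o(w)\le Y$). Consequently $\mathbf{K}\oplus\alpha^{\mathrm K}_{x,y}$ and $\mathbf{K}\oplus\alpha^{\mathrm D}_{x,y}$ are the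 logics of the respective frame classes described in (a) and (b).
   Context: $p_0,\dots,p_{v-1}$ are propositional variables and $m_0,\dots,m_{n-1}$ is an enumeration of the $n=2^v$ Boolean minterms $\bigwedge_{k=0}^{v-1}\pm p_k$ with $m_{n-1}=p_0\wedge\dots\wedge p_{v-1}$. For $\varepsilon_i\in\{0,1\}$, $\Diamond^{1}m_i=\Diamond m_i$ and $\Diamond^{0}m_i=\neg\Diamond m_i$; $1$ denotes the constant true; for $\varepsilon\in\{0,1\}^n$, $\chi(\varepsilon)$ is the number of indices $i$ with $\varepsilon_i=1$. "$o(w)\le\infty$" is always true. $\mathbf{K}\oplus\alpha$ denotes the least normal modal logic containing $\alpha$; a formula is valid on a frame if it is true at every world under every valuation. -}

module Defs where

open import Level using (0ℓ) renaming (suc to lsuc)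
open import Data.Bool using (Bool; true; false; if_then_else_; _∧_)
open import Data.Nat as ℕ using (ℕ; zero; suc; _^_; _∸_; _%_; _/_; _≡ᵇ_; s≤s; z≤n)
open import Data.Nat.Properties using (∸-monoʳ-<; m^n>0)
open import Data.Integer as ℤ using (ℤ; +_; 1ℤ)
open import Data.Fin using (Fin; toℕ; fromℕ<)
open import Data.Vec as Vec using (Vec; []; _∷_; lookup)
open import Data.List as List using (List; []; _∷_; foldr; map; allFin; filterᵇ; concatMap)
open import Data.Product using (Σ; _×_; _,_)
open import Data.Unit using (⊤)
open import Data.Empty using (⊥)
open import Relation.Binary.PropositionalEquality using (_≡_; _≢_)
open import Function.Definitions using (Injective)
open import Function.Bundles using (_⇔_)
open import Data.Sum using (_⊎_)
open import Relation.Nullary using (does)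
import Data.Integer.Properties as ℤP
import Data.Nat.Properties as ℕP

infixr 5 _⇒_
data Fm : Set where
  var : ℕ → Fm
  ⊥' : Fm
  _⇒_ : Fm → Fm → Fm
  □ : Fm → Fm

¬' : Fm → Fm
¬' φ = φ ⇒ ⊥'

⊤' : Fm
⊤' = ¬' ⊥'

_∧'_ : Fm → Fm → Fm
φ ∧' ψ = ¬' (φ ⇒ ¬' ψ)

_∨'_ : Fm → Fm → Fm
φ ∨' ψ = ¬' φ ⇒ ψ

◇ : Fm → Fm
◇ φ = ¬' (□ (¬' φ))

⋀ : List Fm → Fm
⋀ = foldr _∧'_ ⊤'

⋁ : List Fm → Fm
⋁ = foldr _∨'_ ⊥'

record Frame : Set₁ where
  field
    W : Set
    R : W → W → Set

module _ (F : Frame) where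
  open Frame F

  Valuation : Set₁
  Valuation = ℕ → W → Set

  _,_⊨_ : Valuation → W → Fm → Set
  V , w ⊨ var p = V p w
  V , w ⊨ ⊥' = ⊥
  V , w ⊨ (φ ⇒ ψ) = V , w ⊨ φ → V , w ⊨ ψ
  V , w ⊨ □ φ = ∀ u → R w u → V , u ⊨ φ

  Valid : Fm → Set₁
  Valid φ = ∀ (V : Valuation) (w : W) → V , w ⊨ φ

  ProperSuccs : W → (k : ℕ) → (Fin k → W) → Set
  ProperSuccs w k f = Injective _≡_ _≡_ f × (∀ j → f j ≢ w × R w (f j))

  o≥ : W → ℕ → Set
  o≥ w k = Σ (Fin k → W) (ProperSuccs w k)

  Reflexive-at : W → Set
  Reflexive-at w = R w w

data Bound : Set where
  fin : ℤ → Bound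
  ∞ : Bound

o≤ : (F : Frame) → Frame.W F → Bound → Set
o≤ F w (fin z) = ∀ (k : ℕ) (f : Fin k → Frame.W F) → ProperSuccs F w k f → + k ℤ.≤ z
o≤ F w ∞ = ⊤

-- Minterms over p₀ … p_{v-1}, enumerated by Fin (2 ^ v):
-- m_i has p_k positive iff bit k of i is 1, so m_{2^v - 1} = p₀ ∧ … ∧ p_{v-1}.

bits : (v : ℕ) → ℕ → Vec Bool v
bits zero _ = []
bits (suc v) m = (m % 2 ≡ᵇ 1) ∷ bits v (m / 2)

minterm : (v : ℕ) → Fin (2 ^ v) → Fm
minterm v i = ⋀ (map lit (allFin v))
  where
  lit : Fin v → Fm
  lit k = if lookup (bits v (toℕ i)) k then var (toℕ k) else ¬' (var (toℕ k))

lastIdx : (v : ℕ) → Fin (2 ^ v)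
lastIdx v = fromℕ< {2 ^ v ∸ 1} (∸-monoʳ-< {2 ^ v} {1} {0} (s≤s z≤n) (m^n>0 2 v))

◇^ : Bool → Fm → Fm
◇^ true φ = ◇ φ
◇^ false φ = ¬' (◇ φ)

χ : ∀ {n} → Vec Bool n → ℕ
χ [] = 0
χ (true ∷ ε) = suc (χ ε)
χ (false ∷ ε) = χ ε

allVecs : (n : ℕ) → List (Vec Bool n)
allVecs zero = [] ∷ []
allVecs (suc n) = concatMap (λ ε → (false ∷ ε) ∷ (true ∷ ε) ∷ []) (allVecs n)

inE : (v x : ℕ) (y : ℤ) → Vec Bool (2 ^ v) → Bool
inE v x y ε with lookup ε (lastIdx v)
... | false = χ ε ℕ.≤ᵇ x
... | true = + χ ε ℤ.≤ᵇ (y ℤ.+ 1ℤ)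

αK : (v x : ℕ) (y : ℤ) → Fm
αK v x y =
  minterm v (lastIdx v) ⇒
    ⋁ (map (λ ε → minterm v (lastIdx v) ∧'
                   ⋀ (map (λ i → ◇^ (lookup ε i) (minterm v i)) (allFin (2 ^ v))))
           (filterᵇ (inE v x y) (allVecs (2 ^ v))))

αD : (v x : ℕ) (y : ℤ) → Fm
αD v x y = ◇ ⊤' ∧' αK v x y

Xb : (v x : ℕ) (y : ℤ) → Bound
Xb v x y = if does (x ℕP.≟ (2 ^ v ∸ 1)) ∧ does (y ℤP.≟ + (2 ^ v ∸ 1))
           then ∞ else fin (+ x)

Yb : (v : ℕ) (y : ℤ) → Bound
Yb v y = if does (y ℤP.≟ + (2 ^ v ∸ 1)) then ∞ else fin y

ClassK : (v x : ℕ) (y : ℤ) → Frame → Set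
ClassK v x y F = ∀ (w : Frame.W F) →
    ((Frame.R F w w → ⊥) × o≤ F w (Xb v x y)) ⊎ (Frame.R F w w × o≤ F w (Yb v y))

ClassD : (v x : ℕ) (y : ℤ) → Frame → Set
ClassD v x y F = ∀ (w : Frame.W F) →
    ((Frame.R F w w → ⊥) × o≥ F w 1 × o≤ F w (Xb v x y)) ⊎ (Frame.R F w w × o≤ F w (Yb v y))

subst : (ℕ → Fm) → Fm → Fm
subst σ (var p) = σ p
subst σ ⊥' = ⊥'
subst σ (φ ⇒ ψ) = subst σ φ ⇒ subst σ ψ
subst σ (□ φ) = □ (subst σ φ)

data K⊕ (α : Fm) : Fm → Set where
  ax1 : ∀ φ ψ → K⊕ α (φ ⇒ ψ ⇒ φ)
  ax2 : ∀ φ ψ χ' → K⊕ α ((φ ⇒ ψ ⇒ χ') ⇒ (φ ⇒ ψ) ⇒ φ ⇒ χ')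
  ax3 : ∀ φ → K⊕ α (¬' (¬' φ) ⇒ φ)
  axK : ∀ φ ψ → K⊕ α (□ (φ ⇒ ψ) ⇒ □ φ ⇒ □ ψ)
  axα : K⊕ α α
  mp : ∀ {φ ψ} → K⊕ α (φ ⇒ ψ) → K⊕ α φ → K⊕ α ψ
  nec : ∀ {φ} → K⊕ α φ → K⊕ α (□ φ)
  usub : ∀ {φ} (σ : ℕ → Fm) → K⊕ α φ → K⊕ α (subst σ φ)

LogicOf : (Frame → Set) → Fm → Set₁
LogicOf C φ = ∀ (F : Frame) → C F → Valid F φ

{-# OPTIONS --safe #-}

-- For a world w satisfying the last minterm m_{n-1}, αK holds at w exactly when the set of minterms
-- realised at successors of w has at most x elements if m_{n-1} is not among them, and at most y + 1
-- if it is. Distinct realised minterms need distinct successors, so this number is bounded by o(w),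
-- plus one for w itself when w is reflexive. Conversely, if w has too many proper successors, a
-- valuation giving w the minterm m_{n-1} and the successors pairwise distinct other minterms refutes
-- αK; v ≥ 1 is what keeps all remaining worlds off m_{n-1}.
-- Completeness repeats this refutation in an unravelled canonical model, in which distinct successors
-- of a world are separated by formulas: the refuting valuation is then definable, so it comes from a
-- substitution instance of αK, which is a theorem. For αD = ◇⊤ ∧ αK both sides add seriality.

module Submission where

open import Defs renaming (subst to substᶠ)
open import Level using (0ℓ)
open import Axiom.ExcludedMiddle using (ExcludedMiddle)
open import Axiom.DoubleNegationElimination using (em⇒dne)
open import Data.Bool using (Bool; true; false; if_then_else_; T)
open import Data.Bool.Properties using (T?)
open import Data.Empty using (⊥; ⊥-elim)
open import Data.Fin using (Fin; zero; suc; toℕ; fromℕ<; inject≤; punchIn)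
import Data.Fin.Properties as FinP
open import Data.Fin.Properties
  using (toℕ-injective; toℕ<n; toℕ-fromℕ<; toℕ-inject≤; inject≤-injective; injective⇒≤; punchIn-injective; punchInᵢ≢i)
open import Data.Integer as ℤ using (ℤ; +_; -[1+_]; -1ℤ; 1ℤ; +≤+) renaming (_≤_ to _≤ℤ_)
import Data.Integer.Properties as ℤP
open import Data.List using (List; []; _∷_; _++_; map; allFin; filterᵇ; cartesianProductWith)
open import Data.List.Membership.Propositional using (_∈_; find; lose)
open import Data.List.Membership.Propositional.Properties
  using (∈-filter⁺; ∈-filter⁻; ∈-concatMap⁺; ∈-map⁺; ∈-++⁺ˡ; ∈-++⁺ʳ; ∈-cartesianProductWith⁺)
open import Data.List.Relation.Unary.All using (All; []; _∷_)
import Data.List.Relation.Unary.All.Properties as AllP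
open import Data.List.Relation.Unary.Any as Any using (Any; here; there)
import Data.List.Relation.Unary.Any.Properties as AnyP
open import Data.Nat as ℕ using (ℕ; zero; suc; _+_; _*_; _^_; _∸_; _%_; _/_; _≡ᵇ_; _≤_; _<_; z≤n; s≤s)
import Data.Nat.Properties as ℕP
open import Data.Nat.DivMod
  using ([m+kn]%n≡m%n; m*n%n≡0; +-distrib-/; m*n/n≡m; m%n<n; m≡m%n+[m/n]*n; m<n*o⇒m/o<n; m<n⇒m%n≡m; m<n⇒m/n≡0)
open import Data.Product using (Σ; Σ-syntax; _×_; _,_; proj₁; proj₂)
open import Data.Product.Function.NonDependent.Propositional using (_×-⇔_)
open import Data.Sum as Sum using (_⊎_; inj₁; inj₂; [_,_]′)
open import Data.Vec using (Vec; []; _∷_; lookup; replicate; tabulate)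
open import Data.Vec.Functional as Vector using (Vector)
open import Data.Vec.Properties using (lookup-replicate; lookup∘tabulate)
open import Data.Vec.Relation.Binary.Pointwise.Extensional using (ext; Pointwise-≡⇒≡)
open import Function using (_∘_; case_of_)
open import Function.Bundles using (_⇔_; mk⇔; Equivalence)
open import Function.Definitions using (Injective)
import Function.Properties.Equivalence as ⇔
open import Relation.Binary using (tri<; tri≈; tri>)
open import Relation.Binary.PropositionalEquality
  using (_≡_; _≢_; refl; sym; trans; cong; cong₂; subst; module ≡-Reasoning)
open import Relation.Nullary using (¬_; Dec; yes; no; does)

open Equivalence using (to; from)

bool-ext : ∀ {b c} → (b ≡ true ⇔ c ≡ true) → b ≡ c
bool-ext {true} b⇔c = sym (to b⇔c refl)
bool-ext {false} {false} _ = refl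
bool-ext {false} {true} b⇔c = from b⇔c refl

bitValue : Bool → ℕ
bitValue true = 1
bitValue false = 0

fromBits : ∀ {v} → Vec Bool v → ℕ
fromBits [] = 0
fromBits (b ∷ bs) = bitValue b + fromBits bs * 2

bitValue<2 : ∀ b → bitValue b < 2
bitValue<2 true = s≤s (s≤s z≤n)
bitValue<2 false = s≤s z≤n

bitValue-isBit : ∀ b → (bitValue b ≡ᵇ 1) ≡ b
bitValue-isBit true = refl
bitValue-isBit false = refl

bitValue-%2 : ∀ m → bitValue (m % 2 ≡ᵇ 1) ≡ m % 2
bitValue-%2 m with m % 2 | m%n<n m 2
... | 0 | _ = refl
... | 1 | _ = refl
... | suc (suc _) | s≤s (s≤s ())

bits-fromBits : ∀ {v} (bs : Vec Bool v) → bits v (fromBits bs) ≡ bs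
bits-fromBits [] = refl
bits-fromBits (b ∷ bs) = cong₂ _∷_ low-bit (trans (cong (bits _) high-bits) (bits-fromBits bs))
  where
  b%2≡b : bitValue b % 2 ≡ bitValue b
  b%2≡b = m<n⇒m%n≡m (bitValue<2 b)
  low-bit : ((bitValue b + fromBits bs * 2) % 2 ≡ᵇ 1) ≡ b
  low-bit = trans (cong (_≡ᵇ 1) (trans ([m+kn]%n≡m%n (bitValue b) (fromBits bs) 2) b%2≡b))
                  (bitValue-isBit b)
  no-carry : bitValue b % 2 + fromBits bs * 2 % 2 < 2
  no-carry = subst (_< 2) (sym (trans (cong₂ _+_ b%2≡b (m*n%n≡0 (fromBits bs) 2)) (ℕP.+-identityʳ _)))
                   (bitValue<2 b)
  high-bits : (bitValue b + fromBits bs * 2) / 2 ≡ fromBits bs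
  high-bits = trans (+-distrib-/ (bitValue b) (fromBits bs * 2) no-carry)
                    (cong₂ _+_ (m<n⇒m/n≡0 (bitValue<2 b)) (m*n/n≡m (fromBits bs) 2))

fromBits-bits : ∀ v m → m < 2 ^ v → fromBits (bits v m) ≡ m
fromBits-bits zero zero _ = refl
fromBits-bits zero (suc m) (s≤s ())
fromBits-bits (suc v) m m<2^[1+v] =
  trans (cong₂ _+_ (bitValue-%2 m) (cong (_* 2) (fromBits-bits v (m / 2) m/2<2^v)))
        (sym (m≡m%n+[m/n]*n m 2))
  where
  m/2<2^v : m / 2 < 2 ^ v
  m/2<2^v = m<n*o⇒m/o<n (subst (m <_) (ℕP.*-comm 2 (2 ^ v)) m<2^[1+v])

bits-injective : ∀ v {m k} → m < 2 ^ v → k < 2 ^ v → bits v m ≡ bits v k → m ≡ k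
bits-injective v {m} {k} m< k< eq =
  trans (sym (fromBits-bits v m m<)) (trans (cong fromBits eq) (fromBits-bits v k k<))

suc-fromBits-ones : ∀ v → suc (fromBits (replicate v true)) ≡ 2 ^ v
suc-fromBits-ones zero = refl
suc-fromBits-ones (suc v) = begin
  suc (fromBits ones) * 2 ≡⟨ cong (_* 2) (suc-fromBits-ones v) ⟩
  2 ^ v * 2               ≡⟨ ℕP.*-comm (2 ^ v) 2 ⟩
  2 * 2 ^ v               ∎
  where
  open ≡-Reasoning
  ones = replicate v true

bits-last : ∀ v → bits v (2 ^ v ∸ 1) ≡ replicate v true
bits-last v = trans (cong (λ m → bits v (m ∸ 1)) (sym (suc-fromBits-ones v)))
                    (bits-fromBits (replicate v true))

bitAt : ∀ {v} → Vec Bool v → ℕ → Bool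
bitAt [] _ = false
bitAt (b ∷ bs) zero = b
bitAt (b ∷ bs) (suc j) = bitAt bs j

bitAt-toℕ : ∀ {v} (bs : Vec Bool v) k → bitAt bs (toℕ k) ≡ lookup bs k
bitAt-toℕ (b ∷ bs) zero = refl
bitAt-toℕ (b ∷ bs) (suc k) = bitAt-toℕ bs k

trues : ∀ {n} (ε : Vec Bool n) → Fin (χ ε) → Fin n
trues (true ∷ ε) zero = zero
trues (true ∷ ε) (suc a) = suc (trues ε a)
trues (false ∷ ε) a = suc (trues ε a)

lookup-trues : ∀ {n} (ε : Vec Bool n) a → lookup ε (trues ε a) ≡ true
lookup-trues (true ∷ ε) zero = refl
lookup-trues (true ∷ ε) (suc a) = lookup-trues ε a
lookup-trues (false ∷ ε) a = lookup-trues ε a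

trues-injective : ∀ {n} (ε : Vec Bool n) → Injective _≡_ _≡_ (trues ε)
trues-injective (true ∷ ε) {zero} {zero} _ = refl
trues-injective (true ∷ ε) {suc a} {suc b} eq = cong suc (trues-injective ε (FinP.suc-injective eq))
trues-injective (false ∷ ε) eq = trues-injective ε (FinP.suc-injective eq)

rank : ∀ {n} (ε : Vec Bool n) (i : Fin n) → lookup ε i ≡ true → Fin (χ ε)
rank (true ∷ ε) zero _ = zero
rank (true ∷ ε) (suc i) εᵢ = suc (rank ε i εᵢ)
rank (false ∷ ε) (suc i) εᵢ = rank ε i εᵢ

rank-injective : ∀ {n} (ε : Vec Bool n) {i j} εᵢ εⱼ → rank ε i εᵢ ≡ rank ε j εⱼ → i ≡ j
rank-injective (true ∷ ε) {zero} {zero} _ _ _ = refl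
rank-injective (true ∷ ε) {suc i} {suc j} εᵢ εⱼ eq = cong suc (rank-injective ε εᵢ εⱼ (FinP.suc-injective eq))
rank-injective (false ∷ ε) {suc i} {suc j} εᵢ εⱼ eq = cong suc (rank-injective ε εᵢ εⱼ eq)

injection⇒≤χ : ∀ {n m} (ε : Vec Bool n) (h : Fin m → Fin n) → Injective _≡_ _≡_ h →
               (∀ a → lookup ε (h a) ≡ true) → m ≤ χ ε
injection⇒≤χ ε h h-inj εₕ =
  injective⇒≤ {f = λ a → rank ε (h a) (εₕ a)} (λ eq → h-inj (rank-injective ε (εₕ _) (εₕ _) eq))

χ≤length : ∀ {n} (ε : Vec Bool n) → χ ε ≤ n
χ≤length [] = z≤n
χ≤length (true ∷ ε) = s≤s (χ≤length ε)
χ≤length (false ∷ ε) = ℕP.m≤n⇒m≤1+n (χ≤length ε)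

χ<length : ∀ {n} (ε : Vec Bool n) i → lookup ε i ≡ false → χ ε < n
χ<length (true ∷ ε) (suc i) εᵢ = s≤s (χ<length ε i εᵢ)
χ<length (false ∷ ε) zero _ = s≤s (χ≤length ε)
χ<length (false ∷ ε) (suc i) εᵢ = ℕP.m≤n⇒m≤1+n (χ<length ε i εᵢ)

allVecs-complete : ∀ {n} (ε : Vec Bool n) → ε ∈ allVecs n
allVecs-complete [] = here refl
allVecs-complete (b ∷ ε) =
  ∈-concatMap⁺ (λ ε → (false ∷ ε) ∷ (true ∷ ε) ∷ []) (Any.map (λ { refl → either b }) (allVecs-complete ε))
  where
  either : ∀ b → (b ∷ ε) ∈ (false ∷ ε) ∷ (true ∷ ε) ∷ []
  either false = here refl
  either true = there (here refl)

∷-injective : ∀ {A : Set} {m} {x : A} {f : Vector A m} → Injective _≡_ _≡_ f → (∀ a → f a ≢ x) →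
              Injective _≡_ _≡_ (x Vector.∷ f)
∷-injective f-inj f≢x {zero} {zero} _ = refl
∷-injective f-inj f≢x {zero} {suc b} e = ⊥-elim (f≢x b (sym e))
∷-injective f-inj f≢x {suc a} {zero} e = ⊥-elim (f≢x a e)
∷-injective f-inj f≢x {suc a} {suc b} e = cong suc (f-inj e)

restrict : ∀ {A : Set} {m k} → m ≤ k → Vector A k → Vector A m
restrict m≤k f a = f (inject≤ a m≤k)

restrict-injective : ∀ {A : Set} {m k} (m≤k : m ≤ k) {f : Vector A k} → Injective _≡_ _≡_ f →
                     Injective _≡_ _≡_ (restrict m≤k f)
restrict-injective m≤k f-inj e = inject≤-injective m≤k m≤k _ _ (f-inj e)

+≤⇔<suc : ∀ {i t} → i ℤ.+ 1ℤ ≡ + t → ∀ k → + k ≤ℤ i ⇔ k < t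
+≤⇔<suc {+ a} refl k = mk⇔ (λ { (+≤+ k≤a) → subst (suc k ≤_) (ℕP.+-comm 1 a) (s≤s k≤a) })
                           (λ k<a+1 → +≤+ (ℕP.≤-pred (subst (suc k ≤_) (ℕP.+-comm a 1) k<a+1)))
+≤⇔<suc { -[1+ 0 ]} refl k = mk⇔ (λ ()) (λ ())

≡+⇔≡suc : ∀ {i t} → i ℤ.+ 1ℤ ≡ + t → ∀ m → i ≡ + m ⇔ t ≡ suc m
≡+⇔≡suc {+ a} refl m = mk⇔ (λ { refl → ℕP.+-comm m 1 })
                           (λ a+1≡1+m → cong +_ (ℕP.suc-injective (trans (ℕP.+-comm 1 a) a+1≡1+m)))
≡+⇔≡suc { -[1+ 0 ]} refl m = mk⇔ (λ ()) (λ ())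

+1-shift : ∀ {i N} → -1ℤ ≤ℤ i → i ≤ℤ + N → Σ[ t ∈ ℕ ] i ℤ.+ 1ℤ ≡ + t × t ≤ N + 1
+1-shift { -[1+ 0 ]} _ _ = 0 , refl , z≤n
+1-shift {+ a} {N} _ (+≤+ a≤N) = a + 1 , refl , ℕP.+-monoˡ-≤ 1 a≤N
+1-shift { -[1+ suc _ ]} (ℤ.-≤- ()) _

module Semantics (lem : ExcludedMiddle 0ℓ) (F : Frame) where
  open Frame F

  -- A wrapper around the satisfaction relation of Defs, so that V, w and φ can be inferred from it.
  record Sat (V : Valuation F) (w : W) (φ : Fm) : Set where
    constructor sat
    field unsat : _,_⊨_ F V w φ
  open Sat public

  dne : {P : Set} → ¬ ¬ P → P
  dne = em⇒dne lem

  ⊨valid : ∀ φ → Valid F φ ⇔ (∀ V w → Sat V w φ)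
  ⊨valid φ = mk⇔ (λ val V w → sat (val V w)) (λ val V w → unsat (val V w))

  ⊨var : ∀ {V w j} → Sat V w (var j) ⇔ V j w
  ⊨var = mk⇔ unsat sat

  ⊭⊥ : ∀ {V w} → ¬ Sat V w ⊥'
  ⊭⊥ = unsat

  ⊨⇒ : ∀ {V w φ ψ} → Sat V w (φ ⇒ ψ) ⇔ (Sat V w φ → Sat V w ψ)
  ⊨⇒ = mk⇔ (λ s a → sat (unsat s (unsat a))) (λ f → sat λ a → unsat (f (sat a)))

  ⊨□ : ∀ {V w φ} → Sat V w (□ φ) ⇔ (∀ u → R w u → Sat V u φ)
  ⊨□ = mk⇔ (λ s u r → sat (unsat s u r)) (λ f → sat λ u r → unsat (f u r))

  ⊨¬ : ∀ {V w φ} → Sat V w (¬' φ) ⇔ (¬ Sat V w φ)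
  ⊨¬ = mk⇔ (λ s a → ⊭⊥ (to ⊨⇒ s a)) (λ f → from ⊨⇒ (λ a → ⊥-elim (f a)))

  ⊨⊤ : ∀ {V w} → Sat V w ⊤'
  ⊨⊤ = from ⊨¬ ⊭⊥

  ⊨∧ : ∀ {V w φ ψ} → Sat V w (φ ∧' ψ) ⇔ (Sat V w φ × Sat V w ψ)
  ⊨∧ = mk⇔ (λ s → dne (λ ¬φ → to ⊨¬ s (from ⊨⇒ λ a → from ⊨¬ λ _ → ¬φ a))
            , dne (λ ¬ψ → to ⊨¬ s (from ⊨⇒ λ _ → from ⊨¬ ¬ψ)))
           (λ (a , b) → from ⊨¬ λ f → to ⊨¬ (to ⊨⇒ f a) b)

  ⊨∨ : ∀ {V w φ ψ} → Sat V w (φ ∨' ψ) ⇔ (Sat V w φ ⊎ Sat V w ψ)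
  ⊨∨ {V} {w} {φ} = mk⇔ elim (λ { (inj₁ a) → from ⊨⇒ λ ¬a → ⊥-elim (to ⊨¬ ¬a a)
                               ; (inj₂ b) → from ⊨⇒ λ _ → b })
    where
    elim : ∀ {ψ} → Sat V w (φ ∨' ψ) → Sat V w φ ⊎ Sat V w ψ
    elim s with lem {Sat V w φ}
    ... | yes a = inj₁ a
    ... | no ¬a = inj₂ (to ⊨⇒ s (from ⊨¬ ¬a))

  ⊨⋀ : ∀ {V w} L → Sat V w (⋀ L) ⇔ All (Sat V w) L
  ⊨⋀ [] = mk⇔ (λ _ → []) (λ _ → ⊨⊤)
  ⊨⋀ (φ ∷ L) = mk⇔ (λ s → let a , b = to ⊨∧ s in a ∷ to (⊨⋀ L) b)
                   (λ { (a ∷ as) → from ⊨∧ (a , from (⊨⋀ L) as) })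

  ⊨⋁ : ∀ {V w} L → Sat V w (⋁ L) ⇔ Any (Sat V w) L
  ⊨⋁ [] = mk⇔ (λ s → ⊥-elim (⊭⊥ s)) (λ ())
  ⊨⋁ (φ ∷ L) = mk⇔ (λ s → [ here , (λ b → there (to (⊨⋁ L) b)) ]′ (to ⊨∨ s))
                   (λ { (here a) → from ⊨∨ (inj₁ a) ; (there as) → from ⊨∨ (inj₂ (from (⊨⋁ L) as)) })

  ⊨◇ : ∀ {V w φ} → Sat V w (◇ φ) ⇔ (Σ[ u ∈ W ] R w u × Sat V u φ)
  ⊨◇ = mk⇔ (λ s → dne λ none → to ⊨¬ s (from ⊨□ λ u r → from ⊨¬ λ a → none (u , r , a)))
           (λ (u , r , a) → from ⊨¬ λ b → to ⊨¬ (to ⊨□ b u r) a)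

  ⊨⋀-allFin : ∀ {V w m} (f : Fin m → Fm) → Sat V w (⋀ (map f (allFin m))) ⇔ (∀ a → Sat V w (f a))
  ⊨⋀-allFin f = mk⇔ (λ s → AllP.tabulate⁻ (AllP.map⁻ (to (⊨⋀ _) s)))
                    (λ h → from (⊨⋀ _) (AllP.map⁺ (AllP.tabulate⁺ h)))

  ⊨⋁-allFin : ∀ {V w m} (f : Fin m → Fm) → Sat V w (⋁ (map f (allFin m))) ⇔ (Σ[ a ∈ Fin m ] Sat V w (f a))
  ⊨⋁-allFin f = mk⇔ (λ s → AnyP.tabulate⁻ (AnyP.map⁻ (to (⊨⋁ _) s)))
                    (λ (a , fa) → from (⊨⋁ _) (AnyP.map⁺ (AnyP.tabulate⁺ a fa)))

  valid-∧ : ∀ φ ψ → Valid F (φ ∧' ψ) ⇔ (Valid F φ × Valid F ψ)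
  valid-∧ φ ψ = mk⇔
    (λ val → from (⊨valid φ) (λ V w → proj₁ (to ⊨∧ (to (⊨valid (φ ∧' ψ)) val V w)))
           , from (⊨valid ψ) (λ V w → proj₂ (to ⊨∧ (to (⊨valid (φ ∧' ψ)) val V w))))
    (λ (valφ , valψ) → from (⊨valid (φ ∧' ψ)) λ V w →
      from ⊨∧ (to (⊨valid φ) valφ V w , to (⊨valid ψ) valψ V w))

  Serial : Set
  Serial = ∀ w → Σ[ u ∈ W ] R w u

  valid-◇⊤⇔serial : Valid F (◇ ⊤') ⇔ Serial
  valid-◇⊤⇔serial = mk⇔
    (λ val w → let u , wRu , _ = to ⊨◇ (to (⊨valid (◇ ⊤')) val (λ _ _ → ⊥) w) in u , wRu)
    (λ serial → from (⊨valid (◇ ⊤')) λ V w → let u , wRu = serial w in from ⊨◇ (u , wRu , ⊨⊤))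

  o< : W → ℕ → Set
  o< w k = ∀ m (f : Fin m → W) → ProperSuccs F w m f → m < k

  o≤fin⇔ : ∀ {w i s} → i ℤ.+ 1ℤ ≡ + s → o≤ F w (fin i) ⇔ o< w s
  o≤fin⇔ {w} {i} {s} i+1≡s = mk⇔ bounded unbounded
    where
    bounded : o≤ F w (fin i) → o< w s
    bounded o m f pf = to (+≤⇔<suc i+1≡s m) (o m f pf)
    unbounded : o< w s → o≤ F w (fin i)
    unbounded o k f pf = from (+≤⇔<suc i+1≡s k) (o k f pf)

  proper-restrict : ∀ {w m k} (m≤k : m ≤ k) {f : Fin k → W} →
                    ProperSuccs F w k f → ProperSuccs F w m (restrict m≤k f)
  proper-restrict m≤k (f-inj , f-succ) = restrict-injective m≤k f-inj , λ a → f-succ (inject≤ a m≤k)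

  successors-bound : ∀ {w k m} → o< w k →
                     (g : Fin m → W) → Injective _≡_ _≡_ g → (∀ a → R w (g a)) → m ≤ k
  successors-bound {m = zero} _ _ _ _ = z≤n
  successors-bound {w} {m = suc m} o g g-inj gR with lem {Σ[ a ∈ Fin (suc m) ] g a ≡ w}
  ... | no w∉g = ℕP.<⇒≤ (o _ g (g-inj , λ a → (λ e → w∉g (a , e)) , gR a))
  ... | yes (a₀ , g≡w) = o _ (g ∘ punchIn a₀)
    ( (λ e → punchIn-injective a₀ _ _ (g-inj e))
    , λ b → (λ e → punchInᵢ≢i a₀ b (g-inj (trans e (sym g≡w)))) , gR (punchIn a₀ b))

  substValuation : Valuation F → (ℕ → Fm) → Valuation F
  substValuation V σ j u = Sat V u (σ j)

  ⊨substᶠ : ∀ {V w} σ φ → Sat V w (substᶠ σ φ) ⇔ Sat (substValuation V σ) w φ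
  ⊨substᶠ σ (var j) = mk⇔ sat unsat
  ⊨substᶠ σ ⊥' = mk⇔ (λ s → ⊥-elim (⊭⊥ s)) (λ s → ⊥-elim (⊭⊥ s))
  ⊨substᶠ σ (φ ⇒ ψ) = mk⇔ (λ s → from ⊨⇒ λ a → to (⊨substᶠ σ ψ) (to ⊨⇒ s (from (⊨substᶠ σ φ) a)))
                          (λ s → from ⊨⇒ λ a → from (⊨substᶠ σ ψ) (to ⊨⇒ s (to (⊨substᶠ σ φ) a)))
  ⊨substᶠ σ (□ φ) = mk⇔ (λ s → from ⊨□ λ u r → to (⊨substᶠ σ φ) (to ⊨□ s u r))
                        (λ s → from ⊨□ λ u r → from (⊨substᶠ σ φ) (to ⊨□ s u r))

  Pattern : Valuation F → W → ∀ {v} → Vec Bool v → Set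
  Pattern V u bs = ∀ k → V (toℕ k) u ⇔ (lookup bs k ≡ true)

  pattern-unique : ∀ {V u v} {bs cs : Vec Bool v} → Pattern V u bs → Pattern V u cs → bs ≡ cs
  pattern-unique p q = Pointwise-≡⇒≡ (ext λ k → bool-ext (⇔.trans (⇔.sym (p k)) (q k)))

  ⊨literal : ∀ {V u} b j → Sat V u (if b then var j else ¬' (var j)) ⇔ (V j u ⇔ (b ≡ true))
  ⊨literal true j = mk⇔ (λ s → mk⇔ (λ _ → refl) (λ _ → to ⊨var s)) (λ e → from ⊨var (from e refl))
  ⊨literal false j = mk⇔ (λ s → mk⇔ (λ a → ⊥-elim (to ⊨¬ s (from ⊨var a))) (λ ()))
                         (λ e → from ⊨¬ λ a → case to e (to ⊨var a) of λ ())

  ⊨if-⊥ : ∀ {V w} b φ → Sat V w (if b then φ else ⊥') ⇔ (Sat V w φ × b ≡ true)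
  ⊨if-⊥ true φ = mk⇔ (_, refl) proj₁
  ⊨if-⊥ false φ = mk⇔ (λ s → ⊥-elim (⊭⊥ s)) (λ ())

  module Minterms (v : ℕ) where

    ⊨minterm : ∀ {V u} i → Sat V u (minterm v i) ⇔ Pattern V u (bits v (toℕ i))
    ⊨minterm i = mk⇔ (λ s k → to (⊨literal _ (toℕ k)) (to (⊨⋀-allFin _) s k))
                     (λ p → from (⊨⋀-allFin _) (λ k → from (⊨literal _ (toℕ k)) (p k)))

    minterm-unique : ∀ {V u} i j → Sat V u (minterm v i) → Sat V u (minterm v j) → i ≡ j
    minterm-unique {V} {u} i j sᵢ sⱼ = toℕ-injective (bits-injective v (toℕ<n i) (toℕ<n j)
      (pattern-unique {V} {u} (to (⊨minterm {V} {u} i) sᵢ) (to (⊨minterm {V} {u} j) sⱼ)))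

    lookup-bits-last : ∀ k → lookup (bits v (toℕ (lastIdx v))) k ≡ true
    lookup-bits-last k = trans (cong (λ bs → lookup bs k) (trans (cong (bits v) (toℕ-fromℕ< _)) (bits-last v)))
                               (lookup-replicate k true)

    ⊨last : ∀ {V u} → Sat V u (minterm v (lastIdx v)) ⇔ (∀ k → V (toℕ k) u)
    ⊨last = mk⇔ (λ s k → from (to (⊨minterm (lastIdx v)) s k) (lookup-bits-last k))
                (λ h → from (⊨minterm (lastIdx v)) (λ k → mk⇔ (λ _ → lookup-bits-last k) (λ _ → h k)))

    bit : ℕ → Fin (2 ^ v) → Bool
    bit j i = bitAt (bits v (toℕ i)) j

    module Labelling {V : Valuation F} (D : W → Set) {m} (A : Fin m → W → Set) (c : Fin m → Fin (2 ^ v))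
                     (exclusive : ∀ {u a b} → A a u → A b u → a ≡ b)
                     (V⇔ : ∀ j u → V j u ⇔ (D u ⊎ Σ[ a ∈ Fin m ] A a u × bit j (c a) ≡ true)) where

      labelled-last : ∀ {u} → D u → Sat V u (minterm v (lastIdx v))
      labelled-last d = from ⊨last (λ k → from (V⇔ (toℕ k) _) (inj₁ d))

      labelled-code : ∀ {u} a → ¬ D u → A a u → Sat V u (minterm v (c a))
      labelled-code {u} a ¬d aᵤ = from (⊨minterm (c a)) λ k → mk⇔
        (λ vₖ → case to (V⇔ (toℕ k) u) vₖ of λ
          { (inj₁ d) → ⊥-elim (¬d d)
          ; (inj₂ (b , bᵤ , bitₖ)) → trans (sym (bitAt-toℕ (bits v (toℕ (c a))) k))
                                       (subst (λ b → bit (toℕ k) (c b) ≡ true) (exclusive bᵤ aᵤ) bitₖ) })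
        (λ bitₖ → from (V⇔ (toℕ k) u) (inj₂ (a , aᵤ , trans (bitAt-toℕ (bits v (toℕ (c a))) k) bitₖ)))

      labelled-last⇒coded : 1 ≤ v → ∀ {u} → ¬ D u → Sat V u (minterm v (lastIdx v)) →
                            Σ[ a ∈ Fin m ] c a ≡ lastIdx v
      labelled-last⇒coded 1≤v {u} ¬d lastᵤ with to (V⇔ 0 u) (subst (λ j → V j u) p₀ (to ⊨last lastᵤ k₀))
        where
        k₀ = fromℕ< {0} 1≤v
        p₀ = toℕ-fromℕ< 1≤v
      ... | inj₁ d = ⊥-elim (¬d d)
      ... | inj₂ (a , aᵤ , _) = a , minterm-unique (c a) (lastIdx v) (labelled-code a ¬d aᵤ) lastᵤ

nextPair : ℕ × ℕ → ℕ × ℕ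
nextPair (a , zero) = zero , suc a
nextPair (a , suc b) = suc a , b

unpair : ℕ → ℕ × ℕ
unpair zero = zero , zero
unpair (suc k) = nextPair (unpair k)

-- unpair walks along the diagonals a + b = s, from (0 , s) to (s , 0)
unpair-surjective : ∀ s a b → a + b ≡ s → Σ[ k ∈ ℕ ] unpair k ≡ (a , b)
unpair-surjective zero zero zero _ = zero , refl
unpair-surjective (suc s) zero b a+b≡s =
  let k , e = unpair-surjective s s zero (ℕP.+-identityʳ s) in suc k , trans (cong nextPair e) (cong (zero ,_) (sym a+b≡s))
unpair-surjective s (suc a) b a+b≡s =
  let k , e = unpair-surjective s a (suc b) (trans (ℕP.+-suc a b) a+b≡s) in suc k , cong nextPair e

formulasUpTo : ℕ → List Fm
formulasUpTo zero = ⊥' ∷ []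
formulasUpTo (suc s) = var s ∷ L ++ map □ L ++ cartesianProductWith _⇒_ L L
  where L = formulasUpTo s

formulasUpTo-mono : ∀ {s φ} k → φ ∈ formulasUpTo s → φ ∈ formulasUpTo (k + s)
formulasUpTo-mono zero φ∈ = φ∈
formulasUpTo-mono (suc k) φ∈ = there (∈-++⁺ˡ (formulasUpTo-mono k φ∈))

formulasUpTo-complete : ∀ φ → Σ[ s ∈ ℕ ] φ ∈ formulasUpTo s
formulasUpTo-complete (var j) = suc j , here refl
formulasUpTo-complete ⊥' = zero , here refl
formulasUpTo-complete (□ φ) =
  let s , φ∈ = formulasUpTo-complete φ in suc s , there (∈-++⁺ʳ (formulasUpTo s) (∈-++⁺ˡ (∈-map⁺ □ φ∈)))
formulasUpTo-complete (φ ⇒ ψ) =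
  let s₁ , φ∈ = formulasUpTo-complete φ
      s₂ , ψ∈ = formulasUpTo-complete ψ
      s = s₂ + s₁
      φ∈′ = formulasUpTo-mono s₂ φ∈
      ψ∈′ = subst (λ r → ψ ∈ formulasUpTo r) (ℕP.+-comm s₁ s₂) (formulasUpTo-mono s₁ ψ∈)
  in suc s , there (∈-++⁺ʳ (formulasUpTo s) (∈-++⁺ʳ (map □ (formulasUpTo s))
                   (∈-cartesianProductWith⁺ _⇒_ φ∈′ ψ∈′)))

nth : List Fm → ℕ → Fm
nth [] _ = ⊥'
nth (φ ∷ L) zero = φ
nth (φ ∷ L) (suc i) = nth L i

nth-complete : ∀ {φ} L → φ ∈ L → Σ[ i ∈ ℕ ] nth L i ≡ φ
nth-complete (ψ ∷ L) (here refl) = zero , refl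
nth-complete (ψ ∷ L) (there φ∈) = let i , e = nth-complete L φ∈ in suc i , e

formula : ℕ → Fm
formula k = let s , i = unpair k in nth (formulasUpTo s) i

formula-surjective : ∀ φ → Σ[ k ∈ ℕ ] formula k ≡ φ
formula-surjective φ =
  let s , φ∈ = formulasUpTo-complete φ
      i , e = nth-complete (formulasUpTo s) φ∈
      k , e′ = unpair-surjective (s + i) s i refl
  in k , trans (cong (λ (s , i) → nth (formulasUpTo s) i) e′) e

-- The frame condition of αK

module AlphaK (lem : ExcludedMiddle 0ℓ) (v x : ℕ) (y : ℤ) (t : ℕ) (y+1≡t : y ℤ.+ 1ℤ ≡ + t)
              (1≤v : 1 ≤ v) (x≤N : x ≤ 2 ^ v ∸ 1) (x≤t : x ≤ t) (t≤n : t ≤ 2 ^ v) where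

  n = 2 ^ v
  N = 2 ^ v ∸ 1
  last = lastIdx v

  suc-N : suc N ≡ n
  suc-N = trans (ℕP.+-comm 1 N) (ℕP.m∸n+n≡m (ℕP.m^n>0 2 v))

  N<n : N < n
  N<n = subst (N <_) suc-N ℕP.≤-refl

  t≢n⇒t≤N : t ≢ n → t ≤ N
  t≢n⇒t≤N t≢n = ℕP.≤-pred (subst (t <_) (sym suc-N) (ℕP.≤∧≢⇒< t≤n t≢n))

  nonLast : ∀ {m} → m ≤ N → Fin m → Fin n
  nonLast m≤N a = inject≤ a (ℕP.≤-trans m≤N (ℕP.<⇒≤ N<n))

  nonLast-injective : ∀ {m} (m≤N : m ≤ N) → Injective _≡_ _≡_ (nonLast m≤N)
  nonLast-injective m≤N = restrict-injective (ℕP.≤-trans m≤N (ℕP.<⇒≤ N<n)) (λ e → e)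

  nonLast≢last : ∀ {m} (m≤N : m ≤ N) a → nonLast m≤N a ≢ last
  nonLast≢last m≤N a e = ℕP.<⇒≢ (ℕP.<-≤-trans (toℕ<n a) m≤N)
    (trans (sym (toℕ-inject≤ a _)) (trans (cong toℕ e) (toℕ-fromℕ< _)))

  withLast : ∀ {m} → m ≤ N → Fin (suc m) → Fin n
  withLast m≤N = last Vector.∷ nonLast m≤N

  withLast-injective : ∀ {m} (m≤N : m ≤ N) → Injective _≡_ _≡_ (withLast m≤N)
  withLast-injective m≤N = ∷-injective (nonLast-injective m≤N) (nonLast≢last m≤N)

  y≡N⇔t≡n : y ≡ + N ⇔ t ≡ n
  y≡N⇔t≡n = ⇔.trans (≡+⇔≡suc y+1≡t N) (mk⇔ (λ e → trans e suc-N) (λ e → trans e (sym suc-N)))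

  AdmissibleAt : Bool → ℕ → Set
  AdmissibleAt false k = k ≤ x
  AdmissibleAt true k = k ≤ t

  Admissible : Vec Bool n → Set
  Admissible ε = AdmissibleAt (lookup ε last) (χ ε)

  admissible-last : ∀ ε → Admissible ε → lookup ε last ≡ true → χ ε ≤ t
  admissible-last ε adm εₗ = subst (λ b → AdmissibleAt b (χ ε)) εₗ adm

  admissible-¬last : ∀ ε → Admissible ε → lookup ε last ≡ false → χ ε ≤ x
  admissible-¬last ε adm εₗ = subst (λ b → AdmissibleAt b (χ ε)) εₗ adm

  admissible-by-cases : ∀ ε → (lookup ε last ≡ false → χ ε ≤ x) → (lookup ε last ≡ true → χ ε ≤ t) →
                        Admissible ε
  admissible-by-cases ε ¬last-bound last-bound with lookup ε last
  ... | false = ¬last-bound refl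
  ... | true = last-bound refl

  χ≤N : ∀ ε → lookup ε last ≡ false → χ ε ≤ N
  χ≤N ε εₗ = ℕP.≤-pred (subst (χ ε <_) (sym suc-N) (χ<length ε last εₗ))

  inE⇔admissible : ∀ ε → T (inE v x y ε) ⇔ Admissible ε
  inE⇔admissible ε with lookup ε last
  ... | false = mk⇔ (ℕP.≤ᵇ⇒≤ _ _) ℕP.≤⇒≤ᵇ
  ... | true = mk⇔ (λ le → ℤP.drop‿+≤+ (subst (+ χ ε ≤ℤ_) y+1≡t (ℤP.≤ᵇ⇒≤ le)))
                   (λ le → ℤP.≤⇒≤ᵇ (subst (+ χ ε ≤ℤ_) (sym y+1≡t) (+≤+ le)))

  module _ (F : Frame) where
    open Frame F
    open Semantics lem F
    open Minterms v

    Realised : Valuation F → W → Fin n → Set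
    Realised V w i = Σ[ u ∈ W ] R w u × Sat V u (minterm v i)

    realised : Valuation F → W → Vec Bool n
    realised V w = tabulate (λ i → does (lem {Realised V w i}))

    realised⇔ : ∀ {V w} i → lookup (realised V w) i ≡ true ⇔ Realised V w i
    realised⇔ {V} {w} i rewrite lookup∘tabulate (λ i → does (lem {Realised V w i})) i with lem {Realised V w i}
    ... | yes r = mk⇔ (λ _ → r) (λ _ → refl)
    ... | no ¬r = mk⇔ (λ ()) (λ r → ⊥-elim (¬r r))

    unrealised⇒false : ∀ {V w i} → ¬ Realised V w i → lookup (realised V w) i ≡ false
    unrealised⇒false {V} {w} {i} ¬r with lookup (realised V w) i in εᵢ
    ... | false = refl
    ... | true = ⊥-elim (¬r (to (realised⇔ i) εᵢ))

    ⊨◇^ : ∀ {V w} b φ → Sat V w (◇^ b φ) ⇔ (b ≡ true ⇔ Sat V w (◇ φ))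
    ⊨◇^ true φ = mk⇔ (λ s → mk⇔ (λ _ → s) (λ _ → refl)) (λ e → to e refl)
    ⊨◇^ false φ = mk⇔ (λ s → mk⇔ (λ ()) (λ d → ⊥-elim (to ⊨¬ s d)))
                      (λ e → from ⊨¬ λ d → case from e d of λ ())

    diamonds : Vec Bool n → Fm
    diamonds ε = ⋀ (map (λ i → ◇^ (lookup ε i) (minterm v i)) (allFin n))

    ⊨diamonds : ∀ {V w} ε → Sat V w (diamonds ε) ⇔ ε ≡ realised V w
    ⊨diamonds {V} {w} ε = mk⇔
      (λ s → Pointwise-≡⇒≡ (ext λ i → bool-ext (⇔.trans (to (⊨◇^ (lookup ε i) (minterm v i)) (to (⊨⋀-allFin _) s i))
                                                (⇔.trans ⊨◇ (⇔.sym (realised⇔ i))))))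
      (λ { refl → from (⊨⋀-allFin _) λ i → from (⊨◇^ _ _) (⇔.trans (realised⇔ i) (⇔.sym ⊨◇)) })

    ⊨αK : ∀ {V w} → Sat V w (αK v x y) ⇔ (Sat V w (minterm v last) → Admissible (realised V w))
    ⊨αK {V} {w} = mk⇔ admissible αK-holds
      where
      candidates = filterᵇ (inE v x y) (allVecs n)
      body : Vec Bool n → Fm
      body ε = minterm v last ∧' diamonds ε

      admissible : Sat V w (αK v x y) → Sat V w (minterm v last) → Admissible (realised V w)
      admissible s lastʷ with find (AnyP.map⁻ (to (⊨⋁ (map body candidates)) (to ⊨⇒ s lastʷ)))
      ... | ε , ε∈ , sε = subst Admissible (to (⊨diamonds ε) (proj₂ (to ⊨∧ sε)))
                                 (to (inE⇔admissible ε) (proj₂ (∈-filter⁻ (T? ∘ inE v x y) {xs = allVecs n} ε∈)))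

      αK-holds : (Sat V w (minterm v last) → Admissible (realised V w)) → Sat V w (αK v x y)
      αK-holds adm = from ⊨⇒ λ lastʷ →
        let ε∈ = ∈-filter⁺ (T? ∘ inE v x y) (allVecs-complete ε) (from (inE⇔admissible ε) (adm lastʷ))
        in from (⊨⋁ (map body candidates)) (AnyP.map⁺ (lose ε∈ (from ⊨∧ (lastʷ , from (⊨diamonds ε) refl))))
        where
        ε = realised V w

    o≤+x⇔ : ∀ {w} → ¬ (x ≡ N × t ≡ n) → o≤ F w (fin (+ x)) ⇔ ((x ≡ N × t ≡ n) ⊎ o< w (suc x))
    o≤+x⇔ ¬∞ = ⇔.trans (o≤fin⇔ (cong +_ (ℕP.+-comm x 1)))
                       (mk⇔ inj₂ [ (λ ∞ → ⊥-elim (¬∞ ∞)) , (λ o → o) ]′)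

    o≤X⇔ : ∀ {w} → o≤ F w (Xb v x y) ⇔ ((x ≡ N × t ≡ n) ⊎ o< w (suc x))
    o≤X⇔ {w} with x ℕ.≡ᵇ N in x≟N | y ℤP.≟ + N
    ... | true | yes y≡N =
      mk⇔ (λ _ → inj₁ (ℕP.≡ᵇ⇒≡ x N (subst T (sym x≟N) _) , to y≡N⇔t≡n y≡N)) (λ _ → _)
    ... | true | no y≢N = o≤+x⇔ (λ (_ , t≡n) → y≢N (from y≡N⇔t≡n t≡n))
    ... | false | _ = o≤+x⇔ (λ (x≡N , _) → subst T x≟N (ℕP.≡⇒≡ᵇ x N x≡N))

    o≤Y⇔ : ∀ {w} → o≤ F w (Yb v y) ⇔ (t ≡ n ⊎ o< w t)
    o≤Y⇔ {w} with y ℤP.≟ + N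
    ... | yes y≡N = mk⇔ (λ _ → inj₁ (to y≡N⇔t≡n y≡N)) (λ _ → _)
    ... | no y≢N = ⇔.trans (o≤fin⇔ y+1≡t)
                           (mk⇔ inj₂ [ (λ t≡n → ⊥-elim (y≢N (from y≡N⇔t≡n t≡n))) , (λ o → o) ]′)

    -- injective because a world satisfies only one minterm
    realisers : ∀ V w → Σ[ g ∈ (Fin (χ (realised V w)) → W) ] Injective _≡_ _≡_ g × (∀ a → R w (g a))
    realisers V w = g , g-injective , λ a → proj₁ (proj₂ (realiser a))
      where
      ε = realised V w
      realiser : ∀ a → Realised V w (trues ε a)
      realiser a = to (realised⇔ (trues ε a)) (lookup-trues ε a)
      g = λ a → proj₁ (realiser a)
      g-injective : Injective _≡_ _≡_ g
      g-injective {a} {b} e = trues-injective ε (minterm-unique (trues ε a) (trues ε b) (proj₂ (proj₂ (realiser a)))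
        (subst (λ u → Sat V u (minterm v (trues ε b))) (sym e) (proj₂ (proj₂ (realiser b)))))

    realised-injection⇒≤χ : ∀ {V w M} (d : Fin M → Fin n) → Injective _≡_ _≡_ d → (∀ a → Realised V w (d a)) →
                            M ≤ χ (realised V w)
    realised-injection⇒≤χ {V} {w} d d-inj r = injection⇒≤χ (realised V w) d d-inj (λ a → from (realised⇔ (d a)) (r a))

    irreflexive⇒χ-realised< : ∀ {V w k} → ¬ R w w → o< w k → χ (realised V w) < k
    irreflexive⇒χ-realised< {V} {w} irr o =
      let g , g-inj , gR = realisers V w in o _ g (g-inj , λ a → (λ g≡w → irr (subst (R w) g≡w (gR a))) , gR a)

    χ-realised≤ : ∀ {V w k} → o< w k → χ (realised V w) ≤ k
    χ-realised≤ {V} {w} o = let g , g-inj , gR = realisers V w in successors-bound o g g-inj gR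

    ClassK-at : W → Set
    ClassK-at w = ((R w w → ⊥) × o≤ F w (Xb v x y)) ⊎ (R w w × o≤ F w (Yb v y))

    classK-at⇒χ≤t : ∀ {V w} → ClassK-at w → χ (realised V w) ≤ t
    classK-at⇒χ≤t {V} {w} =
      [ (λ (irr , oX) → [ (λ (_ , t≡n) → χ≤n t≡n) , (λ o → ℕP.≤-trans (ℕP.≤-pred (irreflexive⇒χ-realised< irr o)) x≤t) ]′
                          (to o≤X⇔ oX))
      , (λ (_ , oY) → [ χ≤n , χ-realised≤ ]′ (to o≤Y⇔ oY)) ]′
      where
      χ≤n : t ≡ n → χ (realised V w) ≤ t
      χ≤n t≡n = subst (χ (realised V w) ≤_) (sym t≡n) (χ≤length (realised V w))

    classK-at⇒χ≤x : ∀ {V w} → ClassK-at w → Sat V w (minterm v last) → lookup (realised V w) last ≡ false →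
                    χ (realised V w) ≤ x
    classK-at⇒χ≤x {V} {w} cl lastʷ εₗ =
      [ (λ (irr , oX) → [ (λ (x≡N , _) → subst (χ (realised V w) ≤_) (sym x≡N) (χ≤N (realised V w) εₗ))
                        , (λ o → ℕP.≤-pred (irreflexive⇒χ-realised< irr o)) ]′ (to o≤X⇔ oX))
      , (λ (wRw , _) → case trans (sym εₗ) (from (realised⇔ last) (w , wRw , lastʷ)) of λ ()) ]′ cl

    classK⇒valid : (∀ w → ClassK-at w) → Valid F (αK v x y)
    classK⇒valid cl = from (⊨valid (αK v x y)) λ V w → from ⊨αK λ lastʷ →
      admissible-by-cases (realised V w) (classK-at⇒χ≤x (cl w) lastʷ) (λ _ → classK-at⇒χ≤t (cl w))

    -- The only use made of αK (valid, or a substitution instance in a canonical model) when bounding o(w).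
    record Realisation (w : W) {m} (f : Fin m → W) (c : Fin m → Fin n) : Set₁ where
      field
        V : Valuation F
        αK-true : Sat V w (αK v x y)
        last-at-w : Sat V w (minterm v last)
        code-at : ∀ a → Sat V (f a) (minterm v (c a))
        last-coded : ¬ R w w → ∀ u → R w u → Sat V u (minterm v last) → Σ[ a ∈ Fin m ] c a ≡ last

      admissible : Admissible (realised V w)
      admissible = to ⊨αK αK-true last-at-w

      realised-code : ProperSuccs F w m f → ∀ a → Realised V w (c a)
      realised-code (_ , f-succ) a = f a , proj₂ (f-succ a) , code-at a

      count≤x : ∀ {M} (d : Fin M → Fin n) → Injective _≡_ _≡_ d → (∀ a → Realised V w (d a)) →
                ¬ Realised V w last → M ≤ x
      count≤x d d-inj r ¬rₗ = ℕP.≤-trans (realised-injection⇒≤χ d d-inj r)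
                                         (admissible-¬last (realised V w) admissible (unrealised⇒false ¬rₗ))

      count≤t : ∀ {M} (d : Fin M → Fin n) → Injective _≡_ _≡_ d → (∀ a → Realised V w (d a)) →
                Realised V w last → M ≤ t
      count≤t d d-inj r rₗ = ℕP.≤-trans (realised-injection⇒≤χ d d-inj r)
                                        (admissible-last (realised V w) admissible (from (realised⇔ last) rₗ))

    Realisable : W → Set₁
    Realisable w = ∀ {m} (f : Fin m → W) → ProperSuccs F w m f → (c : Fin m → Fin n) → Realisation w f c

    realisable⇒irreflexive-bound : ∀ {w} → ¬ R w w → Realisable w → suc x ≤ N → o< w (suc x)
    realisable⇒irreflexive-bound {w} irr ρ x<N m f pf with m ℕP.≤? x
    ... | yes m≤x = s≤s m≤x
    ... | no m≰x = ⊥-elim (ℕP.n≮n x (count≤x (nonLast x<N) (nonLast-injective x<N) (realised-code pf′) ¬lastᵣ))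
      where
      pf′ = proper-restrict (ℕP.≰⇒> m≰x) pf
      open Realisation (ρ _ pf′ (nonLast x<N))
      ¬lastᵣ : ¬ Realised V w last
      ¬lastᵣ (u , wRu , lastᵤ) = let a , e = last-coded irr u wRu lastᵤ in nonLast≢last x<N a e

    realisable⇒last-bound : ∀ {w} → Realisable w → t ≤ N → o< w (suc t)
    realisable⇒last-bound {w} ρ t≤N m f pf with m ℕP.≤? t
    ... | yes m≤t = s≤s m≤t
    ... | no m≰t = ⊥-elim (ℕP.n≮n t (count≤t (withLast t≤N) (withLast-injective t≤N)
                                             (realised-code pf′) (realised-code pf′ zero)))
      where
      pf′ = proper-restrict (ℕP.≰⇒> m≰t) pf
      open Realisation (ρ _ pf′ (withLast t≤N))

    realisable⇒reflexive-bound : ∀ {w} → R w w → Realisable w → t ≤ N → o< w t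
    realisable⇒reflexive-bound {w} wRw ρ t≤N m f pf with suc m ℕP.≤? t
    ... | yes m<t = m<t
    ... | no m≮t = ⊥-elim (ℕP.n≮n t (count≤t (withLast t≤N) (withLast-injective t≤N) realisedᵃ (realisedᵃ zero)))
      where
      pf′ = proper-restrict (ℕP.≮⇒≥ m≮t) pf
      open Realisation (ρ _ pf′ (nonLast t≤N))
      realisedᵃ : ∀ a → Realised V w (withLast t≤N a)
      realisedᵃ zero = w , wRw , last-at-w
      realisedᵃ (suc a) = realised-code pf′ a

    realisable⇒classK-at : ∀ {w} → Realisable w → ClassK-at w
    realisable⇒classK-at {w} ρ with lem {R w w}
    ... | yes wRw = inj₂ (wRw , from o≤Y⇔ Y-bound)
      where
      Y-bound : t ≡ n ⊎ o< w t
      Y-bound with t ℕP.≟ n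
      ... | yes t≡n = inj₁ t≡n
      ... | no t≢n = inj₂ (realisable⇒reflexive-bound wRw ρ (t≢n⇒t≤N t≢n))
    ... | no irr = inj₁ (irr , from o≤X⇔ X-bound)
      where
      X-bound : (x ≡ N × t ≡ n) ⊎ o< w (suc x)
      X-bound with x ℕP.≟ N | t ℕP.≟ n
      ... | yes x≡N | yes t≡n = inj₁ (x≡N , t≡n)
      ... | no x≢N | _ = inj₂ (realisable⇒irreflexive-bound irr ρ (ℕP.≤∧≢⇒< x≤N x≢N))
      ... | yes x≡N | no t≢n = inj₂ λ m f pf →
        ℕP.≤-trans (realisable⇒last-bound ρ (t≢n⇒t≤N t≢n) m f pf) (s≤s (subst (t ≤_) (sym x≡N) (t≢n⇒t≤N t≢n)))

    valid⇒realisable : Valid F (αK v x y) → ∀ w → Realisable w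
    valid⇒realisable val w f (f-inj , f-succ) c = record
      { V = V
      ; αK-true = to (⊨valid (αK v x y)) val V w
      ; last-at-w = labelled-last refl
      ; code-at = λ a → labelled-code a (proj₁ (f-succ a)) refl
      ; last-coded = λ irr u wRu → labelled-last⇒coded 1≤v (λ u≡w → irr (subst (R w) u≡w wRu))
      }
      where
      V : Valuation F
      V j u = u ≡ w ⊎ Σ[ a ∈ Fin _ ] u ≡ f a × bit j (c a) ≡ true
      open Labelling (_≡ w) (λ a u → u ≡ f a) c (λ u≡fa u≡fb → f-inj (trans (sym u≡fa) u≡fb))
                     (λ _ _ → ⇔.refl)

    validK⇔classK : Valid F (αK v x y) ⇔ ClassK v x y F
    validK⇔classK = mk⇔ (λ val w → realisable⇒classK-at (valid⇒realisable val w)) classK⇒valid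

    classD⇔serial×classK : ClassD v x y F ⇔ (Serial × ClassK v x y F)
    classD⇔serial×classK = mk⇔
      (λ cl → successor cl , λ w → [ (λ (irr , _ , oX) → inj₁ (irr , oX)) , inj₂ ]′ (cl w))
      (λ (serial , cl) w → [ (λ (irr , oX) → inj₁ (irr , proper-successor serial irr , oX)) , inj₂ ]′ (cl w))
      where
      successor : ClassD v x y F → Serial
      successor cl w = [ (λ (_ , (f , _ , f-succ) , _) → f zero , proj₂ (f-succ zero))
                       , (λ (wRw , _) → w , wRw) ]′ (cl w)
      proper-successor : Serial → ∀ {w} → ¬ R w w → o≥ F w 1
      proper-successor serial {w} irr = let u , wRu = serial w in
        (λ _ → u) , (λ { {zero} {zero} _ → refl }) , λ _ → (λ u≡w → irr (subst (R w) u≡w wRu)) , wRu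

    validD⇔classD : Valid F (αD v x y) ⇔ ClassD v x y F
    validD⇔classD = ⇔.trans (valid-∧ (◇ ⊤') (αK v x y))
                            (⇔.trans (valid-◇⊤⇔serial ×-⇔ validK⇔classK) (⇔.sym classD⇔serial×classK))

-- Canonical and unravelled models of K ⊕ α

module Canonical (lem : ExcludedMiddle 0ℓ) (α : Fm) where

  infix 3 _⊢_
  data _⊢_ (Γ : Fm → Set) : Fm → Set where
    hyp : ∀ {φ} → Γ φ → Γ ⊢ φ
    thm : ∀ {φ} → K⊕ α φ → Γ ⊢ φ
    _·_ : ∀ {φ ψ} → Γ ⊢ (φ ⇒ ψ) → Γ ⊢ φ → Γ ⊢ ψ

  infixl 5 _·_ _,,_

  _,,_ : (Fm → Set) → Fm → Fm → Set
  (Γ ,, φ) ψ = Γ ψ ⊎ ψ ≡ φ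

  Consistent : (Fm → Set) → Set
  Consistent Γ = ¬ (Γ ⊢ ⊥')

  K⊕-id : ∀ φ → K⊕ α (φ ⇒ φ)
  K⊕-id φ = mp (mp (ax2 φ (φ ⇒ φ) φ) (ax1 φ (φ ⇒ φ))) (ax1 φ φ)

  deduction : ∀ {Γ φ ψ} → Γ ,, φ ⊢ ψ → Γ ⊢ (φ ⇒ ψ)
  deduction {φ = φ} (hyp (inj₁ γ)) = thm (ax1 _ φ) · hyp γ
  deduction {φ = φ} (hyp (inj₂ refl)) = thm (K⊕-id φ)
  deduction {φ = φ} (thm p) = thm (ax1 _ φ) · thm p
  deduction {φ = φ} (_·_ {χ} {ψ} d e) = thm (ax2 φ χ ψ) · deduction d · deduction e

  weaken : ∀ {Γ Δ φ} → (∀ {χ} → Γ χ → Δ χ) → Γ ⊢ φ → Δ ⊢ φ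
  weaken Γ⊆Δ (hyp γ) = hyp (Γ⊆Δ γ)
  weaken Γ⊆Δ (thm p) = thm p
  weaken Γ⊆Δ (d · e) = weaken Γ⊆Δ d · weaken Γ⊆Δ e

  closed : ∀ {φ} → (λ _ → ⊥) ⊢ φ → K⊕ α φ
  closed (thm p) = p
  closed (d · e) = mp (closed d) (closed e)

  ⊢-dne : ∀ {Γ φ} → Γ ⊢ ¬' (¬' φ) → Γ ⊢ φ
  ⊢-dne {φ = φ} d = thm (ax3 φ) · d

  ⊢-efq : ∀ {Γ} φ → Γ ⊢ ⊥' → Γ ⊢ φ
  ⊢-efq φ d = ⊢-dne (thm (ax1 ⊥' (¬' φ)) · d)

  ⊢-□ : ∀ {Γ ψ} → (λ χ → Γ (□ χ)) ⊢ ψ → Γ ⊢ □ ψ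
  ⊢-□ (hyp γ) = hyp γ
  ⊢-□ (thm p) = thm (nec p)
  ⊢-□ (_·_ {χ} {ψ} d e) = thm (axK χ ψ) · ⊢-□ d · ⊢-□ e

  record MCS : Set₁ where
    field
      mem : Fm → Set
      consistent : Consistent mem
      complete : ∀ φ → mem φ ⊎ mem (¬' φ)

  infix 4 _∋_
  _∋_ : MCS → Fm → Set
  Γ ∋ φ = MCS.mem Γ φ

  module _ (Γ : MCS) where
    open MCS Γ

    ∋-closed : ∀ {φ} → mem ⊢ φ → Γ ∋ φ
    ∋-closed {φ} d = [ (λ φ∈ → φ∈) , (λ ¬φ∈ → ⊥-elim (consistent (hyp ¬φ∈ · d))) ]′ (complete φ)

    ∋-theorem : ∀ {φ} → K⊕ α φ → Γ ∋ φ
    ∋-theorem p = ∋-closed (thm p)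

    ∌⊥ : ¬ Γ ∋ ⊥'
    ∌⊥ ⊥∈ = consistent (hyp ⊥∈)

    ∋-¬ : ∀ {φ} → Γ ∋ ¬' φ ⇔ (¬ Γ ∋ φ)
    ∋-¬ {φ} = mk⇔ (λ ¬φ∈ φ∈ → consistent (hyp ¬φ∈ · hyp φ∈))
                  (λ φ∉ → [ (λ φ∈ → ⊥-elim (φ∉ φ∈)) , (λ ¬φ∈ → ¬φ∈) ]′ (complete φ))

    ∋-⇒ : ∀ {φ ψ} → Γ ∋ (φ ⇒ ψ) ⇔ (Γ ∋ φ → Γ ∋ ψ)
    ∋-⇒ {φ} {ψ} = mk⇔ (λ φ⇒ψ∈ φ∈ → ∋-closed (hyp φ⇒ψ∈ · hyp φ∈)) introduce
      where
      introduce : (Γ ∋ φ → Γ ∋ ψ) → Γ ∋ (φ ⇒ ψ)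
      introduce f with complete φ
      ... | inj₁ φ∈ = ∋-closed (thm (ax1 ψ φ) · hyp (f φ∈))
      ... | inj₂ ¬φ∈ = ∋-closed (deduction (⊢-efq ψ (hyp (inj₁ ¬φ∈) · hyp (inj₂ refl))))

  extend : (Q : Fm → Set) (φ : Fm) → Dec (Consistent (Q ,, φ)) → Fm → Set
  extend Q φ (yes _) = Q ,, φ
  extend Q φ (no _) = Q ,, ¬' φ

  extend-consistent : ∀ Q φ d → Consistent Q → Consistent (extend Q φ d)
  extend-consistent Q φ (yes Qφ-cons) _ = Qφ-cons
  extend-consistent Q φ (no Qφ-incons) Q-cons Q¬φ⊢⊥ =
    Q-cons (deduction (em⇒dne lem Qφ-incons) · ⊢-dne (deduction Q¬φ⊢⊥))

  extend-⊇ : ∀ Q φ d {χ} → Q χ → extend Q φ d χ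
  extend-⊇ Q φ (yes _) = inj₁
  extend-⊇ Q φ (no _) = inj₁

  extend-decides : ∀ Q φ d → extend Q φ d φ ⊎ extend Q φ d (¬' φ)
  extend-decides Q φ (yes _) = inj₁ (inj₂ refl)
  extend-decides Q φ (no _) = inj₂ (inj₂ refl)

  lindenbaum : (P : Fm → Set) → Consistent P → Σ[ Γ ∈ MCS ] (∀ {φ} → P φ → Γ ∋ φ)
  lindenbaum P P-cons = Γ , λ φ∈ → zero , φ∈
    where
    chain : ℕ → Fm → Set
    chain zero = P
    chain (suc k) = extend (chain k) (formula k) lem

    chain-consistent : ∀ k → Consistent (chain k)
    chain-consistent zero = P-cons
    chain-consistent (suc k) = extend-consistent (chain k) (formula k) lem (chain-consistent k)

    chain-mono : ∀ {k} i {φ} → chain k φ → chain (i + k) φ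
    chain-mono zero φ∈ = φ∈
    chain-mono (suc i) φ∈ = extend-⊇ _ _ lem (chain-mono i φ∈)

    limit : Fm → Set
    limit φ = Σ[ k ∈ ℕ ] chain k φ

    compact : ∀ {φ} → limit ⊢ φ → Σ[ k ∈ ℕ ] chain k ⊢ φ
    compact (hyp (k , φ∈)) = k , hyp φ∈
    compact (thm p) = zero , thm p
    compact (d · e) with compact d | compact e
    ... | k₁ , d′ | k₂ , e′ =
      k₂ + k₁ , weaken (chain-mono k₂) d′ · weaken (λ {χ} → subst (λ k → chain k χ) (ℕP.+-comm k₁ k₂) ∘ chain-mono k₁) e′

    Γ : MCS
    Γ = record
      { mem = limit
      ; consistent = λ d → let k , dₖ = compact d in chain-consistent k dₖ
      ; complete = λ φ → let k , e = formula-surjective φ in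
          subst (λ ψ → limit ψ ⊎ limit (¬' ψ)) e
            (Sum.map (suc k ,_) (suc k ,_) (extend-decides (chain k) (formula k) lem))
      }

  Rᶜ : MCS → MCS → Set
  Rᶜ Γ Δ = ∀ ψ → Γ ∋ □ ψ → Δ ∋ ψ

  witness : ∀ Γ ψ → Γ ∋ ◇ ψ → Σ[ Δ ∈ MCS ] Rᶜ Γ Δ × Δ ∋ ψ
  witness Γ ψ ◇ψ∈ =
    let Δ , P⊆Δ = lindenbaum P P-consistent in Δ , (λ χ □χ∈ → P⊆Δ (inj₁ □χ∈)) , P⊆Δ (inj₂ refl)
    where
    P = (λ χ → Γ ∋ □ χ) ,, ψ
    P-consistent : Consistent P
    P-consistent P⊢⊥ = to (∋-¬ Γ) ◇ψ∈ (∋-closed Γ (⊢-□ {ψ = ¬' ψ} (deduction P⊢⊥)))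

  refuting-MCS : ∀ {φ} → ¬ K⊕ α φ → Σ[ Γ ∈ MCS ] ¬ Γ ∋ φ
  refuting-MCS {φ} φ∉K⊕α = let Γ , P⊆Γ = lindenbaum (_≡ ¬' φ) P-consistent in Γ , to (∋-¬ Γ) (P⊆Γ refl)
    where
    P-consistent : Consistent (_≡ ¬' φ)
    P-consistent P⊢⊥ = φ∉K⊕α (closed (⊢-dne (deduction (weaken inj₂ P⊢⊥))))

  ∌□⇒∋◇¬ : ∀ Γ {ψ} → ¬ Γ ∋ □ ψ → Γ ∋ ◇ (¬' ψ)
  ∌□⇒∋◇¬ Γ {ψ} □ψ∉ = from (∋-¬ Γ) λ □¬¬ψ∈ → □ψ∉ (∋-closed Γ (thm (mp (axK _ ψ) (nec (ax3 ψ))) · hyp □¬¬ψ∈))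

  child : (Γ : MCS) (ψ : Fm) → Dec (Γ ∋ ◇ ψ) → MCS
  child Γ ψ (yes ◇ψ∈) = proj₁ (witness Γ ψ ◇ψ∈)
  child Γ ψ (no _) = Γ

  child-spec : ∀ Γ ψ d → Γ ∋ ◇ ψ → Rᶜ Γ (child Γ ψ d) × child Γ ψ d ∋ ψ
  child-spec Γ ψ (yes ◇ψ∈) _ = proj₂ (witness Γ ψ ◇ψ∈)
  child-spec Γ ψ (no ◇ψ∉) ◇ψ∈ = ⊥-elim (◇ψ∉ ◇ψ∈)

  childAt : MCS → ℕ → MCS
  childAt Γ c = child Γ (formula c) lem

  -- The c-th child of Γ is used only if the diamond formula c is not already witnessed by Γ itself
  -- or by an earlier used child; this makes distinct successors distinguishable by formulas.
  mutual
    Active : MCS → ℕ → Set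
    Active Γ c = Γ ∋ ◇ (formula c) × ¬ (Rᶜ Γ Γ × Γ ∋ formula c) × ¬ CoveredBelow Γ c c

    CoveredBelow : MCS → ℕ → ℕ → Set
    CoveredBelow Γ c zero = ⊥
    CoveredBelow Γ c (suc d) = (Active Γ d × childAt Γ d ∋ formula c) ⊎ CoveredBelow Γ c d

  covered⇔ : ∀ {Γ c} d → CoveredBelow Γ c d ⇔ (Σ[ c′ ∈ ℕ ] c′ < d × Active Γ c′ × childAt Γ c′ ∋ formula c)
  covered⇔ zero = mk⇔ (λ ()) (λ ())
  covered⇔ (suc d) = mk⇔
    [ (λ (act , ∋c) → d , ℕP.≤-refl , act , ∋c)
    , (λ cov → let c′ , c′<d , rest = to (covered⇔ d) cov in c′ , ℕP.m≤n⇒m≤1+n c′<d , rest) ]′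
    (λ (c′ , c′<1+d , rest) → [ (λ c′<d → inj₂ (from (covered⇔ d) (c′ , c′<d , rest))) , (λ { refl → inj₁ rest }) ]′
                               (ℕP.m≤n⇒m<n∨m≡n (ℕP.≤-pred c′<1+d)))

  active-child-∋ : ∀ {Γ c} → Active Γ c → childAt Γ c ∋ formula c
  active-child-∋ {Γ} {c} (◇∈ , _) = proj₂ (child-spec Γ (formula c) lem ◇∈)

  active-child-∌ : ∀ {Γ c c′} → Active Γ c → Active Γ c′ → c′ < c → ¬ childAt Γ c′ ∋ formula c
  active-child-∌ (_ , _ , ¬cov) act′ c′<c ∋c = ¬cov (from (covered⇔ _) (_ , c′<c , act′ , ∋c))

  separator : ℕ → ℕ → Fm
  separator c d with ℕP.<-cmp c d
  ... | tri< _ _ _ = ¬' (formula d)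
  ... | tri≈ _ _ _ = ⊤'
  ... | tri> _ _ _ = formula c

  child-∋-separator : ∀ {Γ c d} → Active Γ c → Active Γ d → childAt Γ c ∋ separator c d
  child-∋-separator {Γ} {c} {d} act-c act-d with ℕP.<-cmp c d
  ... | tri< c<d _ _ = from (∋-¬ (childAt Γ c)) (active-child-∌ act-d act-c c<d)
  ... | tri≈ _ _ _ = ∋-theorem (childAt Γ c) (K⊕-id ⊥')
  ... | tri> _ _ _ = active-child-∋ act-c

  separator-exclusive : ∀ Δ {c d} → Δ ∋ separator c d → Δ ∋ separator d c → c ≡ d
  separator-exclusive Δ {c} {d} ∋cd ∋dc with ℕP.<-cmp c d | ℕP.<-cmp d c
  ... | tri≈ _ c≡d _ | _ = c≡d
  ... | _ | tri≈ _ d≡c _ = sym d≡c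
  ... | tri< _ _ _ | tri> _ _ _ = ⊥-elim (to (∋-¬ Δ) ∋cd ∋dc)
  ... | tri> _ _ _ | tri< _ _ _ = ⊥-elim (to (∋-¬ Δ) ∋dc ∋cd)
  ... | tri< c<d _ _ | tri< d<c _ _ = ⊥-elim (ℕP.<-asym c<d d<c)
  ... | tri> _ _ c>d | tri> _ _ d>c = ⊥-elim (ℕP.<-asym c>d d>c)

  module Unravelled (Γ₀ : MCS) where

    label : List ℕ → MCS
    label [] = Γ₀
    label (c ∷ p) = childAt (label p) c

    _⟶_ : List ℕ → List ℕ → Set
    p ⟶ q = (Σ[ c ∈ ℕ ] q ≡ c ∷ p × Active (label p) c) ⊎ (q ≡ p × Rᶜ (label p) (label p))

    frame : Frame
    frame = record { W = List ℕ ; R = _⟶_ }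

    valuation : Valuation frame
    valuation j p = label p ∋ var j

    open Semantics lem frame

    ⟶⇒Rᶜ : ∀ {p q} → p ⟶ q → Rᶜ (label p) (label q)
    ⟶⇒Rᶜ {p} (inj₁ (c , refl , (◇∈ , _))) = proj₁ (child-spec (label p) (formula c) lem ◇∈)
    ⟶⇒Rᶜ (inj₂ (refl , r)) = r

    ∋◇⇒witnessed : ∀ {p c} → label p ∋ ◇ (formula c) → Σ[ q ∈ List ℕ ] p ⟶ q × label q ∋ formula c
    ∋◇⇒witnessed {p} {c} ◇∈ with lem {Active (label p) c}
    ... | yes act = c ∷ p , inj₁ (c , refl , act) , active-child-∋ act
    ... | no ¬act with lem {Rᶜ (label p) (label p) × label p ∋ formula c}
    ...   | yes (r , ∋c) = p , inj₂ (refl , r) , ∋c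
    ...   | no ¬self = let c′ , _ , act′ , ∋c = to (covered⇔ c) (em⇒dne lem λ ¬cov → ¬act (◇∈ , ¬self , ¬cov))
                       in c′ ∷ p , inj₁ (c′ , refl , act′) , ∋c

    truth : ∀ φ {p} → Sat valuation p φ ⇔ label p ∋ φ
    truth (var j) = ⊨var
    truth ⊥' {p} = mk⇔ (λ s → ⊥-elim (⊭⊥ s)) (λ ∋⊥ → ⊥-elim (∌⊥ (label p) ∋⊥))
    truth (φ ⇒ ψ) {p} = ⇔.trans ⊨⇒ (⇔.trans (mk⇔ (λ f a → to (truth ψ) (f (from (truth φ) a)))
                                            (λ f a → from (truth ψ) (f (to (truth φ) a))))
                                       (⇔.sym (∋-⇒ (label p))))
    truth (□ ψ) {p} = mk⇔ boxed (λ □ψ∈ → from ⊨□ λ q p⟶q → from (truth ψ) (⟶⇒Rᶜ p⟶q ψ □ψ∈))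
      where
      boxed : Sat valuation p (□ ψ) → label p ∋ □ ψ
      boxed s = em⇒dne lem λ □ψ∉ →
        let c , c≡¬ψ = formula-surjective (¬' ψ)
            q , p⟶q , ∋¬ψ = ∋◇⇒witnessed {p} {c} (subst (λ χ → label p ∋ ◇ χ) (sym c≡¬ψ) (∌□⇒∋◇¬ (label p) □ψ∉))
        in to (∋-¬ (label q)) (subst (label q ∋_) c≡¬ψ ∋¬ψ) (to (truth ψ) (to ⊨□ s q p⟶q))

    successor-child : ∀ {p q} → p ⟶ q → q ≢ p → Σ[ c ∈ ℕ ] q ≡ c ∷ p × Active (label p) c
    successor-child (inj₁ is-child) _ = is-child
    successor-child (inj₂ (q≡p , _)) q≢p = ⊥-elim (q≢p q≡p)

    separating : ∀ p {m} (cs : Fin m → ℕ) → Injective _≡_ _≡_ cs → (∀ a → Active (label p) (cs a)) →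
      Σ[ δ ∈ (Fin m → Fm) ] (∀ a → Sat valuation (cs a ∷ p) (δ a))
                          × (∀ {u a b} → Sat valuation u (δ a) → Sat valuation u (δ b) → a ≡ b)
    separating p {m} cs cs-inj act = δ , child-⊨ , exclusive
      where
      δ : Fin m → Fm
      δ a = ⋀ (map (λ b → separator (cs a) (cs b)) (allFin m))
      child-⊨ : ∀ a → Sat valuation (cs a ∷ p) (δ a)
      child-⊨ a = from (⊨⋀-allFin _) λ b → from (truth _) (child-∋-separator (act a) (act b))
      exclusive : ∀ {u a b} → Sat valuation u (δ a) → Sat valuation u (δ b) → a ≡ b
      exclusive {u} {a} {b} ⊨δa ⊨δb = cs-inj (separator-exclusive (label u)
        (to (truth _) (to (⊨⋀-allFin _) ⊨δa b)) (to (truth _) (to (⊨⋀-allFin _) ⊨δb a)))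

    root-separator : ∀ p {m} (cs : Fin m → ℕ) → (∀ a → Active (label p) (cs a)) →
      Σ[ D ∈ Fm ] Sat valuation p D × (∀ a → ¬ Sat valuation (cs a ∷ p) D)
                × (¬ p ⟶ p → ∀ q → p ⟶ q → ¬ Sat valuation q D)
    root-separator p {m} cs act with lem {Rᶜ (label p) (label p)}
    ... | yes r = D , ⊨D , ⊭D , λ ¬p⟶p → ⊥-elim (¬p⟶p (inj₂ (refl , r)))
      where
      D = ⋀ (map (λ a → ¬' (formula (cs a))) (allFin m))
      ⊨D : Sat valuation p D
      ⊨D = from (⊨⋀-allFin _) λ a → from (truth _) (from (∋-¬ (label p)) λ ∋c → proj₁ (proj₂ (act a)) (r , ∋c))
      ⊭D : ∀ a → ¬ Sat valuation (cs a ∷ p) D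
      ⊭D a s = to ⊨¬ (to (⊨⋀-allFin _) s a) (from (truth _) (active-child-∋ (act a)))
    ... | no ¬r = ¬' ψ , from (truth (¬' ψ)) (from (∋-¬ (label p)) ψ∉)
                , (λ a → ⊭¬ψ (inj₁ (cs a , refl , act a))) , λ _ q → ⊭¬ψ
      where
      ψ□ : Σ[ ψ ∈ Fm ] label p ∋ □ ψ × ¬ label p ∋ ψ
      ψ□ = em⇒dne lem λ none → ¬r λ ψ □ψ∈ → em⇒dne lem λ ψ∉ → none (ψ , □ψ∈ , ψ∉)
      ψ = proj₁ ψ□
      ψ∉ = proj₂ (proj₂ ψ□)
      ⊭¬ψ : ∀ {q} → p ⟶ q → ¬ Sat valuation q (¬' ψ)
      ⊭¬ψ p⟶q s = to ⊨¬ s (from (truth ψ) (⟶⇒Rᶜ p⟶q ψ (proj₁ (proj₂ ψ□))))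

-- Soundness and completeness of K ⊕ α with respect to a frame class

module _ (lem : ExcludedMiddle 0ℓ) (α : Fm) (C : Frame → Set) where
  open Canonical lem α

  soundness : (∀ F → C F → Valid F α) → ∀ {φ} → K⊕ α φ → LogicOf C φ
  soundness C⊨α (ax1 φ ψ) F _ V w a _ = a
  soundness C⊨α (ax2 φ ψ χ) F _ V w f g a = f a (g a)
  soundness C⊨α (ax3 φ) F _ V w ¬¬φ = em⇒dne lem ¬¬φ
  soundness C⊨α (axK φ ψ) F _ V w f g u r = f u r (g u r)
  soundness C⊨α axα F F∈C = C⊨α F F∈C
  soundness C⊨α (mp d e) F F∈C V w = soundness C⊨α d F F∈C V w (soundness C⊨α e F F∈C V w)
  soundness C⊨α (nec d) F F∈C V w u _ = soundness C⊨α d F F∈C V u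
  soundness C⊨α (usub {φ} σ d) F F∈C V w =
    unsat (from (⊨substᶠ σ φ) (sat (soundness C⊨α d F F∈C (substValuation V σ) w)))
    where open Semantics lem F

  completeness : (∀ Γ₀ → let open Unravelled Γ₀ in
                   (∀ σ p → Semantics.Sat lem frame valuation p (substᶠ σ α)) → C frame) →
                 ∀ {φ} → LogicOf C φ → K⊕ α φ
  completeness unravelled∈C {φ} C⊨φ = em⇒dne lem λ φ∉K⊕α →
    let Γ₀ , φ∉Γ₀ = refuting-MCS φ∉K⊕α
        open Unravelled Γ₀
        open Semantics lem frame using (sat)
        instances σ p = from (truth (substᶠ σ α)) (∋-theorem (label p) (usub σ axα))
    in φ∉Γ₀ (to (truth φ) (sat (C⊨φ frame (unravelled∈C Γ₀ instances) valuation [])))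

module UnravelledAlphaK (lem : ExcludedMiddle 0ℓ) (v x : ℕ) (y : ℤ) (t : ℕ) (y+1≡t : y ℤ.+ 1ℤ ≡ + t)
                        (1≤v : 1 ≤ v) (x≤N : x ≤ 2 ^ v ∸ 1) (x≤t : x ≤ t) (t≤n : t ≤ 2 ^ v)
                        (α : Fm) (Γ₀ : Canonical.MCS lem α) where
  open AlphaK lem v x y t y+1≡t 1≤v x≤N x≤t t≤n
  open Canonical lem α
  open Unravelled Γ₀
  open Semantics lem frame
  open Minterms v

  unravelled-realisable : (∀ σ p → Sat valuation p (substᶠ σ (αK v x y))) → ∀ p → Realisable frame p
  unravelled-realisable αK-instances p {m} f (f-inj , f-succ) c = record
    { V = substValuation valuation σ
    ; αK-true = to (⊨substᶠ σ (αK v x y)) (αK-instances σ p)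
    ; last-at-w = labelled-last ⊨D
    ; code-at = λ a → subst (λ q → Sat (substValuation valuation σ) q (minterm v (c a))) (sym (f≡child a))
                            (labelled-code a (⊭D a) (child-⊨δ a))
    ; last-coded = λ irr q p⟶q → labelled-last⇒coded 1≤v (⊭D-successors irr q p⟶q)
    }
    where
    as-child : ∀ a → Σ[ c ∈ ℕ ] f a ≡ c ∷ p × Active (label p) c
    as-child a = successor-child (proj₂ (f-succ a)) (proj₁ (f-succ a))
    cs = λ a → proj₁ (as-child a)
    f≡child = λ a → proj₁ (proj₂ (as-child a))
    act = λ a → proj₂ (proj₂ (as-child a))
    cs-inj : Injective _≡_ _≡_ cs
    cs-inj {a} {b} e = f-inj (trans (f≡child a) (trans (cong (_∷ p) e) (sym (f≡child b))))

    separation = separating p cs cs-inj act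
    δ = proj₁ separation
    child-⊨δ = proj₁ (proj₂ separation)

    root = root-separator p cs act
    D = proj₁ root
    ⊨D = proj₁ (proj₂ root)
    ⊭D = proj₁ (proj₂ (proj₂ root))
    ⊭D-successors = proj₂ (proj₂ (proj₂ root))

    σ : ℕ → Fm
    σ j = D ∨' ⋁ (map (λ a → if bit j (c a) then δ a else ⊥') (allFin m))

    σ⇔ : ∀ j q → Sat valuation q (σ j) ⇔
                 (Sat valuation q D ⊎ Σ[ a ∈ Fin m ] Sat valuation q (δ a) × bit j (c a) ≡ true)
    σ⇔ j q = ⇔.trans ⊨∨ (mk⇔ (Sum.map₂ λ s → let a , sₐ = to (⊨⋁-allFin _) s in a , to (⊨if-⊥ _ _) sₐ)
                              (Sum.map₂ λ (a , sₐ) → from (⊨⋁-allFin _) (a , from (⊨if-⊥ _ _) sₐ)))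

    open Labelling (λ q → Sat valuation q D) (λ a q → Sat valuation q (δ a)) c (proj₂ (proj₂ separation)) σ⇔

  unravelled-classK : (∀ σ p → Sat valuation p (substᶠ σ (αK v x y))) → ClassK v x y frame
  unravelled-classK αK-instances p = realisable⇒classK-at frame (unravelled-realisable αK-instances p)

  unravelled-classD : (∀ σ p → Sat valuation p (substᶠ σ (αD v x y))) → ClassD v x y frame
  unravelled-classD αD-instances = from (classD⇔serial×classK frame) (serial , unravelled-classK αK-instances)
    where
    αK-instances = λ σ p → proj₂ (to ⊨∧ (αD-instances σ p))
    serial : Serial
    serial p = let q , p⟶q , _ = to ⊨◇ (proj₁ (to ⊨∧ (αD-instances var p))) in q , p⟶q

theorem11 : ExcludedMiddle 0ℓ →
    ∀ (v x : ℕ) (y : ℤ) → 1 ≤ v → x ≤ 2 ^ v ∸ 1 → -1ℤ ≤ℤ y → y ≤ℤ + (2 ^ v ∸ 1) → + x ≤ℤ y ℤ.+ 1ℤ →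
    ((F : Frame) → (Valid F (αK v x y) ⇔ ClassK v x y F) × (Valid F (αD v x y) ⇔ ClassD v x y F))
    × ((φ : Fm) → K⊕ (αK v x y) φ ⇔ LogicOf (ClassK v x y) φ)
    × ((φ : Fm) → K⊕ (αD v x y) φ ⇔ LogicOf (ClassD v x y) φ)
theorem11 lem v x y 1≤v x≤N -1≤y y≤N x≤y+1 =
  (λ F → validK⇔classK F , validD⇔classD F)
  , (λ φ → mk⇔ (soundness lem _ _ λ F → from (validK⇔classK F)) (completeness lem _ _ (unravelled-classK _)))
  , (λ φ → mk⇔ (soundness lem _ _ λ F → from (validD⇔classD F)) (completeness lem _ _ (unravelled-classD _)))
  where
  t = proj₁ (+1-shift -1≤y y≤N)
  y+1≡t = proj₁ (proj₂ (+1-shift -1≤y y≤N))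
  x≤t = ℤP.drop‿+≤+ (subst (+ x ≤ℤ_) y+1≡t x≤y+1)
  t≤n = subst (t ≤_) (ℕP.m∸n+n≡m (ℕP.m^n>0 2 v)) (proj₂ (proj₂ (+1-shift -1≤y y≤N)))
  open AlphaK lem v x y t y+1≡t 1≤v x≤N x≤t t≤n
  open UnravelledAlphaK lem v x y t y+1≡t 1≤v x≤N x≤t t≤n
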